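{- Let $\mathrm{sort}$ be a sort function satisfying the characteristic property. Let $T$ be a type, $\leq_1$ and $\leq_2$ relations on $T$ with $\leq_1$ total, and $xs : \mathrm{list}\,T$. If $xs$ is pairwise sorted w.r.t. $\leq_2$, then $\mathrm{sort}_{\leq_1}\,xs$ is sorted w.r.t. the lexicographic relation $x \leq_{\mathrm{lex}} y :\Leftrightarrow x \leq_1 y \wedge (y \not\leq_1 x \vee x \leq_2 y)$.
   Context: A relation $R$ is total if $x \mathrel{R} y$ or $y \mathrel{R} x$ for all $x,y$. A list $[x_0,\dots,x_n]$ is sorted w.r.t. $R$ if $x_{i-1} \mathrel{R} x_i$ for all $1 \leq i \leq n$, and pairwise sorted w.r.t. $R$ if $x_i \mathrel{R} x_j$ for all $i<j\leq n$. Lists: $[]$ is the empty list, $x :: s$ is cons, $[x]$ is the singleton list, $\mathbin{+\!\!+}$ is concatenation. A "relation" $\leq$ on a type $T$ is a function $T \to T \to \mathrm{bool}$. The merge of two lists w.r.t. $\leq$ is defined by $[] \mathbin{\land\hspace{ -.45em}\land}_\leq ys = ys$, $xs \mathbin{\land\hspace{ -.45em}\land}_\leq [] = xs$, and $(x :: xs) \mathbin{\land\hspace{ -.45em}\land}_\leq (y :: ys) = x :: (xs \mathbin{\land\hspace{ -.45em}\land}_\leq (y :: ys))$ if $x \leq y$, and $= y :: ((x :: xs) \mathbin{\land\hspace{ -.45em}\land}_\leq ys)$ otherwise. A sort function $\mathrm{sort}$ assigns to every type $T$ and relation $\leq$ on $T$ a function $\mathrm{sort}_\leq : \mathrm{list}\,T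 \to \mathrm{list}\,T$. It satisfies the characteristic property if there is a polymorphic function $\mathrm{asort}$ of type $\forall (T\,R : \mathcal{U}), (R \to R \to R) \to (T \to R) \to R \to \mathrm{list}\,T \to R$ such that: (1) for all $T$, $\leq$, $xs$: $\mathrm{asort}\,(\mathbin{\land\hspace{ -.45em}\land}_\leq)\,(\lambda x.[x])\,[]\,xs = \mathrm{sort}_\leq\,xs$; (2) for all $T$, $xs$: $\mathrm{asort}\,(\mathbin{+\!\!+})\,(\lambda x.[x])\,[]\,xs = xs$; (3) $\mathrm{asort}$ is relationally parametric: for all types $T_1,T_2$ and relation $\sim_T \subseteq T_1 \times T_2$, all types $R_1,R_2$ and relation $\sim_R \subseteq R_1\times R_2$, all $m_i : R_i \to R_i \to R_i$ with $a_1 \sim_R a_2 \wedge b_1 \sim_R b_2 \Rightarrow m_1\,a_1\,b_1 \sim_R m_2\,a_2\,b_2$, all $s_i : T_i \to R_i$ with $x_1 \sim_T x_2 \Rightarrow s_1\,x_1 \sim_R s_2\,x_2$, all $e_i : R_i$ with $e_1 \sim_R e_2$, and all lists $xs_1 : \mathrm{list}\,T_1$, $xs_2 : \mathrm{list}\,T_2$ of equal length that are pointwise $\sim_T$-related, we have $\mathrm{asort}\,m_1\,s_1\,e_1\,xs_1 \sim_R \mathrm{asort}\,m_2\,s_2\,e_2\,xs_2$. -}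

module Defs where

open import Data.Bool using (Bool; true; false; if_then_else_; T; not)
open import Data.List using (List; []; _∷_; [_]; _++_)
open import Data.List.Relation.Binary.Pointwise using (Pointwise)
open import Data.List.Relation.Unary.Linked using (Linked)
open import Data.List.Relation.Unary.AllPairs using (AllPairs)
open import Data.Product using (Σ; _×_)
open import Data.Sum using (_⊎_)
open import Relation.Nullary using (¬_)
open import Relation.Binary.PropositionalEquality using (_≡_)

BRel : Set → Set
BRel A = A → A → Bool

Total : {A : Set} → BRel A → Set
Total {A} r = (x y : A) → T (r x y) ⊎ T (r y x)

Sorted : {A : Set} → BRel A → List A → Set
Sorted r = Linked (λ x y → T (r x y))

PairwiseSorted : {A : Set} → BRel A → List A → Set
PairwiseSorted r = AllPairs (λ x y → T (r x y))

merge : {A : Set} → BRel A → List A → List A → List A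
merge {A} r [] ys = ys
merge {A} r (x ∷ xs) ys = go ys
  where
  -- go ys = (x ∷ xs) ∧∧ ys, with merge r xs available by structural recursion
  go : List A → List A
  go [] = x ∷ xs
  go (y ∷ ys) = if r x y then x ∷ merge r xs (y ∷ ys) else y ∷ go ys

SortFun : Set₁
SortFun = (A : Set) → BRel A → List A → List A

ASort : Set₁
ASort = (A R : Set) → (R → R → R) → (A → R) → R → List A → R

Parametric : ASort → Set₁
Parametric asort =
  (A₁ A₂ : Set) (∼A : A₁ → A₂ → Set)
  (R₁ R₂ : Set) (∼R : R₁ → R₂ → Set)
  (m₁ : R₁ → R₁ → R₁) (m₂ : R₂ → R₂ → R₂) →
  (∀ {a₁ a₂ b₁ b₂} → ∼R a₁ a₂ → ∼R b₁ b₂ → ∼R (m₁ a₁ b₁) (m₂ a₂ b₂)) →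
  (s₁ : A₁ → R₁) (s₂ : A₂ → R₂) →
  (∀ {x₁ x₂} → ∼A x₁ x₂ → ∼R (s₁ x₁) (s₂ x₂)) →
  (e₁ : R₁) (e₂ : R₂) → ∼R e₁ e₂ →
  (xs₁ : List A₁) (xs₂ : List A₂) → Pointwise ∼A xs₁ xs₂ →
  ∼R (asort A₁ R₁ m₁ s₁ e₁ xs₁) (asort A₂ R₂ m₂ s₂ e₂ xs₂)

record CharacteristicProperty (sort : SortFun) : Set₁ where
  field
    asort      : ASort
    asort-sort : (A : Set) (r : BRel A) (xs : List A) →
                 asort A (List A) (merge r) [_] [] xs ≡ sort A r xs
    asort-id   : (A : Set) (xs : List A) →
                 asort A (List A) _++_ [_] [] xs ≡ xs
    asort-param : Parametric asort

lex : {A : Set} → BRel A → BRel A → BRel A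
lex r₁ r₂ x y = r₁ x y Data.Bool.∧ (not (r₁ y x) Data.Bool.∨ r₂ x y)

module Submission where

-- Relate the two instances of asort by parametricity: the one with merge
-- (which is sort) and the one with ++ (which is the identity), through the
-- relation "l₁ is a permutation of l₂ that is ≤lex-sorted whenever l₂ is
-- pairwise ≤₂-sorted".  Merging preserves it: if l₂ = a ++ b is pairwise
-- ≤₂-sorted, every element of a is ≤₂ every element of b, so whenever merge
-- puts x before y they are ≤lex-ordered, by totality of ≤₁ when x ≤₁ y fails.

open import Defs
open import Data.Bool using (true; false; T; if_then_else_)
open import Data.List using (List; []; _∷_; [_]; _++_)
open import Data.List.Properties using (++-identityʳ)
open import Data.List.Membership.Propositional using (_∈_)
open import Data.List.Relation.Unary.Any using (here; there)
open import Data.List.Relation.Unary.All using (All; []; _∷_)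
import Data.List.Relation.Unary.All as All
import Data.List.Relation.Unary.All.Properties as All
open import Data.List.Relation.Unary.AllPairs using (AllPairs; []; _∷_)
open import Data.List.Relation.Unary.Linked using (Linked; []; [-]; _∷_)
open import Data.List.Relation.Binary.Permutation.Propositional
  using (_↭_; prep; ↭-refl; ↭-sym; ↭-trans; ↭-reflexive)
open import Data.List.Relation.Binary.Permutation.Propositional.Properties
  using (shift; ∈-resp-↭)
import Data.List.Relation.Binary.Permutation.Propositional.Properties as ↭
import Data.List.Relation.Binary.Pointwise as Pointwise
open import Data.Product using (_×_; _,_; proj₂)
open import Data.Sum using (inj₁; inj₂)
open import Relation.Binary.PropositionalEquality using (_≡_; refl; sym; subst)

AllPairs-++⁻ : {A : Set} {R : A → A → Set} (xs : List A) {ys : List A} →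
               AllPairs R (xs ++ ys) →
               AllPairs R xs × AllPairs R ys × All (λ x → All (R x) ys) xs
AllPairs-++⁻ []       pys        = [] , pys , []
AllPairs-++⁻ (x ∷ xs) (px ∷ pxys) with AllPairs-++⁻ xs pxys
... | pxs , pys , cross = All.++⁻ˡ xs px ∷ pxs , pys , All.++⁻ʳ xs px ∷ cross

-- The order in which merge r emits x and y is ≼-ascending.
Orients : {A : Set} → BRel A → (A → A → Set) → A → A → Set
Orients r _≼_ x y = if r x y then x ≼ y else y ≼ x

module _ {A : Set} (r : BRel A) where

  merge-↭ : (xs ys : List A) → merge r xs ys ↭ xs ++ ys
  merge-↭ []       ys = ↭-refl
  merge-↭ (x ∷ xs) ys = go ys
    where
    go : (ys : List A) → merge r (x ∷ xs) ys ↭ (x ∷ xs) ++ ys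
    go []       = ↭-reflexive (sym (++-identityʳ (x ∷ xs)))
    go (y ∷ ys) with r x y
    ... | true  = prep x (merge-↭ xs (y ∷ ys))
    ... | false = ↭-trans (prep y (go ys)) (↭-sym (shift y (x ∷ xs) ys))

  module _ {_≼_ : A → A → Set} where

    merge-Linked-∷ : ∀ {z} (xs ys : List A) →
                     Linked _≼_ (z ∷ xs) → Linked _≼_ (z ∷ ys) →
                     (∀ {x y} → x ∈ xs → y ∈ ys → Orients r _≼_ x y) →
                     Linked _≼_ (z ∷ merge r xs ys)
    merge-Linked-∷ []       ys _ zys _ = zys
    merge-Linked-∷ (x ∷ xs) ys zxs   = go ys zxs
      where
      go : ∀ {z} (ys : List A) → Linked _≼_ (z ∷ x ∷ xs) → Linked _≼_ (z ∷ ys) →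
           (∀ {u v} → u ∈ x ∷ xs → v ∈ ys → Orients r _≼_ u v) →
           Linked _≼_ (z ∷ merge r (x ∷ xs) ys)
      go []       zxs         _           _     = zxs
      go (y ∷ ys) (z≼x ∷ xxs) (z≼y ∷ yys) cross
        with r x y | cross (here refl) (here refl)
      ... | true  | x≼y =
        z≼x ∷ merge-Linked-∷ xs (y ∷ ys) xxs (x≼y ∷ yys) (λ i j → cross (there i) j)
      ... | false | y≼x =
        z≼y ∷ go ys (y≼x ∷ xxs) yys (λ i j → cross i (there j))

    merge-Linked : (xs ys : List A) → Linked _≼_ xs → Linked _≼_ ys →
                   (∀ {x y} → x ∈ xs → y ∈ ys → Orients r _≼_ x y) →
                   Linked _≼_ (merge r xs ys)
    merge-Linked []       ys       _   yys _     = yys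
    merge-Linked (x ∷ xs) []       xxs _   _     = xxs
    merge-Linked (x ∷ xs) (y ∷ ys) xxs yys cross
      with r x y | cross (here refl) (here refl)
    ... | true  | x≼y = merge-Linked-∷ xs (y ∷ ys) xxs (x≼y ∷ yys) (λ i j → cross (there i) j)
    ... | false | y≼x = merge-Linked-∷ (x ∷ xs) ys (y≼x ∷ xxs) yys (λ i j → cross i (there j))

module _ {A : Set} (r₁ r₂ : BRel A) where

  lex-orients : Total r₁ → (x y : A) → T (r₂ x y) →
                Orients r₁ (λ u v → T (lex r₁ r₂ u v)) x y
  lex-orients total x y x≤₂y with r₁ x y | r₁ y x | total x y
  ... | true  | true  | _      = x≤₂y
  ... | true  | false | _      = _
  ... | false | true  | _      = _
  ... | false | false | inj₁ ()
  ... | false | false | inj₂ ()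

  LexStable : List A → List A → Set
  LexStable l₁ l₂ = l₁ ↭ l₂ × (PairwiseSorted r₂ l₂ → Sorted (lex r₁ r₂) l₁)

  LexStable-[] : LexStable [] []
  LexStable-[] = ↭-refl , λ _ → []

  LexStable-[_] : (x : A) → LexStable [ x ] [ x ]
  LexStable-[ x ] = ↭-refl , λ _ → [-]

  LexStable-merge : Total r₁ → ∀ {a₁ a₂ b₁ b₂} → LexStable a₁ a₂ → LexStable b₁ b₂ →
                    LexStable (merge r₁ a₁ b₁) (a₂ ++ b₂)
  LexStable-merge total {a₁} {a₂} {b₁} {b₂} (a₁↭a₂ , a-sorted) (b₁↭b₂ , b-sorted) =
    ↭-trans (merge-↭ r₁ a₁ b₁) (↭.++⁺ a₁↭a₂ b₁↭b₂) , sorted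
    where
    sorted : PairwiseSorted r₂ (a₂ ++ b₂) → Sorted (lex r₁ r₂) (merge r₁ a₁ b₁)
    sorted a₂b₂-sorted with AllPairs-++⁻ a₂ a₂b₂-sorted
    ... | a₂-sorted , b₂-sorted , cross =
      merge-Linked r₁ a₁ b₁ (a-sorted a₂-sorted) (b-sorted b₂-sorted)
        λ x∈a₁ y∈b₁ → lex-orients total _ _
          (All.lookup (All.lookup cross (∈-resp-↭ a₁↭a₂ x∈a₁)) (∈-resp-↭ b₁↭b₂ y∈b₁))

theorem3p11 : (sort : SortFun) → CharacteristicProperty sort →
              (A : Set) (r₁ r₂ : BRel A) → Total r₁ → (xs : List A) →
              PairwiseSorted r₂ xs → Sorted (lex r₁ r₂) (sort A r₁ xs)
theorem3p11 sort cp A r₁ r₂ total xs xs-sorted =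
  subst (Sorted (lex r₁ r₂)) (asort-sort A r₁ xs)
    (proj₂ asort-LexStable (subst (PairwiseSorted r₂) (sym (asort-id A xs)) xs-sorted))
  where
  open CharacteristicProperty cp
  asort-LexStable : LexStable r₁ r₂ (asort A (List A) (merge r₁) [_] [] xs)
                                    (asort A (List A) _++_ [_] [] xs)
  asort-LexStable =
    asort-param A A _≡_ (List A) (List A) (LexStable r₁ r₂)
      (merge r₁) _++_ (LexStable-merge r₁ r₂ total)
      [_] [_] (λ { {x} refl → LexStable-[_] r₁ r₂ x })
      [] [] (LexStable-[] r₁ r₂)
      xs xs (Pointwise.refl refl)
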